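{- For the heap clear modality: \begin{align*} [\langle x\rangle:=\bot]b &\equiv b, \tag{E13}\\ [\langle x\rangle:=\bot](e\hookrightarrow e') &\equiv (x\neq e)\wedge(e\hookrightarrow e'), \tag{E14}\\ [\langle x\rangle:=\bot](p\mathrel{*}q) &\equiv [\langle x\rangle:=\bot]p\mathrel{*}[\langle x\rangle:=\bot]q, \tag{E15}\\ [\langle x\rangle:=\bot](p\mathrel{ -\!\!*}q) &\equiv ((p\wedge\neg(x\hookrightarrow -))\mathrel{ -\!\!*}[\langle x\rangle:=\bot]q)\wedge\forall y([\langle x\rangle:=y]p\mathrel{ -\!\!*}[\langle x\rangle:=y]q), \tag{E16} \end{align*} where $y$ is fresh.
   Context: Setting (Dynamic Separation Logic, DSL). Heaps $h$ are finitely-based partial functions $\mathbb{Z}\rightharpoonup\mathbb{Z}$, stores $s$ total functions from integer variables to $\mathbb{Z}$; arithmetic expressions $e$ and Boolean expressions $b$ do not refer to the heap. $h[n:=v]$ sets location $n$ to $v$ (extending the domain if needed) and $h[n:=\bot]$ removes $n$ from the domain. Assertions include $b$, $(e\hookrightarrow e')$ (true iff $s(e)\in\mathrm{dom}(h)$ and $h(s(e))=s(e')$), logical connectives, quantifiers, separating conjunction $p\mathrel{*}q$ (disjoint heap split), separating implication $p\mathrel{ -\!\!*}q$ (every disjoint extension satisfying $p$, joined with the current heap, satisfies $q$), and modalities $[S]p$. $(x\hookrightarrow -)$ abbreviates $\exists z(x\hookrightarrow z)$. Pseudo-instructions, which never fail: heap update $\langle x\rangle:=e$ maps $(h,s)$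 to $(h[s(x):=s(e)],s)$; heap clear $\langle x\rangle:=\bot$ maps $(h,s)$ to $(h[s(x):=\bot],s)$. So $h,s\models[\langle x\rangle:=\bot]p$ iff $h[s(x):=\bot],s\models p$. $\equiv$ denotes semantic equivalence. -}

module Defs where

open import Data.Integer using (ℤ)
import Data.Integer as ℤ
open import Data.Nat using (ℕ)
import Data.Nat as ℕ
open import Data.Maybe using (Maybe; just; nothing)
open import Data.Bool using (Bool; true)
open import Data.List using (List; _∷_)
open import Data.List.Membership.Propositional using (_∈_)
open import Data.Product using (Σ; ∃; _×_; _,_)
open import Data.Sum using (_⊎_)
open import Relation.Nullary using (¬_; yes; no)
open import Relation.Binary.PropositionalEquality using (_≡_; _≢_)

Var : Set
Var = ℕ

Store : Set
Store = Var → ℤ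

_[_↦_] : Store → Var → ℤ → Store
(s [ y ↦ v ]) z with z ℕ.≟ y
... | yes _ = v
... | no  _ = s z

record Heap : Set where
  constructor mkHeap
  field
    get : ℤ → Maybe ℤ
    finite : ∃ λ (L : List ℤ) → ∀ n v → get n ≡ just v → n ∈ L
open Heap public

_[_≔_] : Heap → ℤ → ℤ → Heap
get (h [ n ≔ v ]) m with m ℤ.≟ n
... | yes _ = just v
... | no  _ = get h m
finite (h [ n ≔ v ]) with finite h
... | L , f = n ∷ L , prf
  where
  open import Data.List.Relation.Unary.Any using (here; there)
  prf : ∀ m w → get (h [ n ≔ v ]) m ≡ just w → m ∈ n ∷ L
  prf m w eq with m ℤ.≟ n
  ... | yes m≡n = here m≡n
  ... | no  _   = there (f m w eq)

_[_≔⊥] : Heap → ℤ → Heap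
get (h [ n ≔⊥]) m with m ℤ.≟ n
... | yes _ = nothing
... | no  _ = get h m
finite (h [ n ≔⊥]) with finite h
... | L , f = L , prf
  where
  prf : ∀ m w → get (h [ n ≔⊥]) m ≡ just w → m ∈ L
  prf m w eq with m ℤ.≟ n | eq
  ... | yes _ | ()
  ... | no  _ | eq' = f m w eq'

-- Arithmetic and Boolean expressions do not refer to the heap:
-- they are (semantically) functions of the store only.
Exp : Set
Exp = Store → ℤ

BExp : Set
BExp = Store → Bool

Split : Heap → Heap → Heap → Set
Split h h₁ h₂ = ∀ n →
    (get h₁ n ≡ nothing × get h n ≡ get h₂ n)
  ⊎ (get h₂ n ≡ nothing × get h n ≡ get h₁ n)

_≈ₕ_ : Heap → Heap → Set
h ≈ₕ h' = ∀ n → get h n ≡ get h' n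

Assertion : Set₁
Assertion = Heap → Store → Set

bool : BExp → Assertion
bool b h s = b s ≡ true

_↪_ : Exp → Exp → Assertion
(e ↪ e') h s = get h (e s) ≡ just (e' s)

var : Var → Exp
var x s = s x

_↪- : Var → Assertion
(x ↪-) h s = ∃ λ z → get h (s x) ≡ just z

_≠_ : Exp → Exp → Assertion
(e ≠ e') h s = e s ≢ e' s

_∧_ : Assertion → Assertion → Assertion
(p ∧ q) h s = p h s × q h s

∼_ : Assertion → Assertion
(∼ p) h s = ¬ p h s

All : Var → Assertion → Assertion
All y p h s = ∀ v → p h (s [ y ↦ v ])

_✱_ : Assertion → Assertion → Assertion
(p ✱ q) h s = ∃ λ h₁ → ∃ λ h₂ → Split h h₁ h₂ × p h₁ s × q h₂ s

_-✱_ : Assertion → Assertion → Assertion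
(p -✱ q) h s = ∀ h₁ h₂ → Split h₂ h h₁ → p h₁ s → q h₂ s

[⟨_⟩≔_]_ : Var → Exp → Assertion → Assertion
([⟨ x ⟩≔ e ] p) h s = p (h [ s x ≔ e s ]) s

[⟨_⟩≔⊥]_ : Var → Assertion → Assertion
([⟨ x ⟩≔⊥] p) h s = p (h [ s x ≔⊥]) s

_≡ₐ_ : Assertion → Assertion → Set
p ≡ₐ q = ∀ h s → (p h s → q h s) × (q h s → p h s)

-- Side conditions satisfied by every (syntactic) assertion of DSL

HeapExt : Assertion → Set
HeapExt p = ∀ h h' s → h ≈ₕ h' → p h s → p h' s

FreshIn : Var → Assertion → Set
FreshIn y p = ∀ h s v → (p h s → p h (s [ y ↦ v ])) × (p h (s [ y ↦ v ]) → p h s)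

-- Separating splits are pointwise, so every heap of a split can be patched at
-- the single location s x independently of all other locations.  Each side of
-- each equivalence is obtained from the other by such a patch: clearing the
-- location, or restoring the value it had.  For (E16), an extension h₁ of the
-- cleared heap either leaves s x unallocated, which is the first conjunct, or
-- stores some v there, which is the second conjunct instantiated at y := v.
module Submission where

open import Defs
open import Data.Integer using (ℤ)
import Data.Integer as ℤ
import Data.Nat as ℕ
open import Data.Maybe using (Maybe; just; nothing)
open import Data.Product using (_×_; ∃; _,_; proj₁; proj₂)
open import Data.Sum using (_⊎_; inj₁; inj₂)
open import Data.Empty using (⊥-elim)
open import Relation.Nullary using (¬_; yes; no)
open import Relation.Binary.PropositionalEquality
  using (_≡_; _≢_; refl; sym; trans; cong)

↦-same : ∀ (s : Store) y v → (s [ y ↦ v ]) y ≡ v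
↦-same s y v with y ℕ.≟ y
... | yes _   = refl
... | no y≢y = ⊥-elim (y≢y refl)

↦-other : ∀ (s : Store) y v z → z ≢ y → (s [ y ↦ v ]) z ≡ s z
↦-other s y v z z≢y with z ℕ.≟ y
... | yes z≡y = ⊥-elim (z≢y z≡y)
... | no _    = refl

_[_≔?_] : Heap → ℤ → Maybe ℤ → Heap
h [ n ≔? just v ] = h [ n ≔ v ]
h [ n ≔? nothing ] = h [ n ≔⊥]

≔?-same : ∀ h n m → get (h [ n ≔? m ]) n ≡ m
≔?-same h n (just v) with n ℤ.≟ n
... | yes _   = refl
... | no n≢n = ⊥-elim (n≢n refl)
≔?-same h n nothing with n ℤ.≟ n
... | yes _   = refl
... | no n≢n = ⊥-elim (n≢n refl)

≔?-other : ∀ h n m k → k ≢ n → get (h [ n ≔? m ]) k ≡ get h k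
≔?-other h n (just v) k k≢n with k ℤ.≟ n
... | yes k≡n = ⊥-elim (k≢n k≡n)
... | no _    = refl
≔?-other h n nothing k k≢n with k ℤ.≟ n
... | yes k≡n = ⊥-elim (k≢n k≡n)
... | no _    = refl

record AgreeOff (n : ℤ) (h h' : Heap) : Set where
  constructor agreeOff
  field agree : ∀ k → k ≢ n → get h k ≡ get h' k
open AgreeOff

agreeOff-refl : ∀ n h → AgreeOff n h h
agreeOff-refl n h = agreeOff λ _ _ → refl

agreeOff-sym : ∀ {n h h'} → AgreeOff n h h' → AgreeOff n h' h
agreeOff-sym a = agreeOff λ k k≢n → sym (agree a k k≢n)

≔?-agreeOff : ∀ h n m → AgreeOff n h (h [ n ≔? m ])
≔?-agreeOff h n m = agreeOff λ k k≢n → sym (≔?-other h n m k k≢n)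

restore-≈ₕ : ∀ {n h h' m} → AgreeOff n h h' → get h n ≡ m → h ≈ₕ (h' [ n ≔? m ])
restore-≈ₕ {n} {h} {h'} {m} a atN k with k ℤ.≟ n
... | yes refl = trans atN (sym (≔?-same h' k m))
... | no k≢n   = trans (agree a k k≢n) (sym (≔?-other h' n m k k≢n))

¬allocated⇒nothing : ∀ {h n} → ¬ (∃ λ v → get h n ≡ just v) → get h n ≡ nothing
¬allocated⇒nothing {h} {n} ¬alloc with get h n
... | just v  = ⊥-elim (¬alloc (v , refl))
... | nothing = refl

nothing⇒¬allocated : ∀ {h n} → get h n ≡ nothing → ¬ (∃ λ v → get h n ≡ just v)
nothing⇒¬allocated free (v , alloc) with trans (sym free) alloc
... | ()

SplitAt : Heap → Heap → Heap → ℤ → Set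
SplitAt h h₁ h₂ n =
    (get h₁ n ≡ nothing × get h n ≡ get h₂ n)
  ⊎ (get h₂ n ≡ nothing × get h n ≡ get h₁ n)

splitAt-nothing : ∀ {h h₁ h₂ n} → get h n ≡ nothing → SplitAt h h₁ h₂ n →
                  get h₁ n ≡ nothing × get h₂ n ≡ nothing
splitAt-nothing free (inj₁ (free₁ , h≡h₂)) = free₁ , trans (sym h≡h₂) free
splitAt-nothing free (inj₂ (free₂ , h≡h₁)) = trans (sym h≡h₁) free , free₂

splitAt-right : ∀ {h h₁ h₂ n} → get h₁ n ≡ nothing → SplitAt h h₁ h₂ n →
                get h n ≡ get h₂ n
splitAt-right free₁ (inj₁ (_ , h≡h₂))     = h≡h₂
splitAt-right free₁ (inj₂ (free₂ , h≡h₁)) = trans h≡h₁ (trans free₁ (sym free₂))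

split-patch : ∀ {n h h₁ h₂ h' h₁' h₂'} → Split h h₁ h₂ →
              AgreeOff n h h' → AgreeOff n h₁ h₁' → AgreeOff n h₂ h₂' →
              SplitAt h' h₁' h₂' n → Split h' h₁' h₂'
split-patch {n} sp a a₁ a₂ atN k with k ℤ.≟ n
... | yes refl = atN
... | no k≢n
  rewrite sym (agree a k k≢n) | sym (agree a₁ k k≢n) | sym (agree a₂ k k≢n) = sp k

split-≔? : ∀ h h₁ h₂ n m → Split h h₁ h₂ →
           Split (h [ n ≔? m ]) (h₁ [ n ≔⊥]) (h₂ [ n ≔? m ])
split-≔? h h₁ h₂ n m sp =
  split-patch sp (≔?-agreeOff h n m) (≔?-agreeOff h₁ n nothing) (≔?-agreeOff h₂ n m)
    (inj₁ (≔?-same h₁ n nothing , trans (≔?-same h n m) (sym (≔?-same h₂ n m))))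

update-fresh : ∀ {x y p} → y ≢ x → FreshIn y p → ∀ h s v →
  (([⟨ x ⟩≔ var y ] p) h (s [ y ↦ v ]) → p (h [ s x ≔ v ]) s)
  × (p (h [ s x ≔ v ]) s → ([⟨ x ⟩≔ var y ] p) h (s [ y ↦ v ]))
update-fresh {x} {y} y≢x fresh h s v
  rewrite ↦-other s y v x (λ x≡y → y≢x (sym x≡y)) | ↦-same s y v =
  proj₂ (fresh (h [ s x ≔ v ]) s v) , proj₁ (fresh (h [ s x ≔ v ]) s v)

clear-bool : ∀ (x : Var) (b : BExp) → ([⟨ x ⟩≔⊥] bool b) ≡ₐ bool b
clear-bool x b h s = (λ b-holds → b-holds) , (λ b-holds → b-holds)

clear-↪ : ∀ (x : Var) (e e' : Exp) →
          ([⟨ x ⟩≔⊥] (e ↪ e')) ≡ₐ ((var x ≠ e) ∧ (e ↪ e'))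
clear-↪ x e e' h s = (λ pts → distinct pts , trans (sym (kept (distinct pts))) pts)
                    , (λ (x≢e , pts) → trans (kept x≢e) pts)
  where
  X = s x
  kept : X ≢ e s → get (h [ X ≔⊥]) (e s) ≡ get h (e s)
  kept x≢e = ≔?-other h X nothing (e s) (λ e≡x → x≢e (sym e≡x))
  distinct : get (h [ X ≔⊥]) (e s) ≡ just (e' s) → X ≢ e s
  distinct pts x≡e = nothing⇒¬allocated {h [ X ≔⊥]} {e s} cleared (e' s , pts)
    where
    cleared : get (h [ X ≔⊥]) (e s) ≡ nothing
    cleared = trans (cong (get (h [ X ≔⊥])) (sym x≡e)) (≔?-same h X nothing)

clear-✱ : ∀ (x : Var) (p q : Assertion) → HeapExt p → HeapExt q →
          ([⟨ x ⟩≔⊥] (p ✱ q)) ≡ₐ (([⟨ x ⟩≔⊥] p) ✱ ([⟨ x ⟩≔⊥] q))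
clear-✱ x p q ext-p ext-q h s = to , from
  where
  X = s x
  to : ([⟨ x ⟩≔⊥] (p ✱ q)) h s → (([⟨ x ⟩≔⊥] p) ✱ ([⟨ x ⟩≔⊥] q)) h s
  to (h₁ , h₂ , sp , p₁ , q₂) =
      h₁ [ X ≔? get h X ] , h₂
    , split-patch sp (agreeOff-sym (≔?-agreeOff h X nothing))
        (≔?-agreeOff h₁ X (get h X)) (agreeOff-refl X h₂)
        (inj₂ (free₂ , sym (≔?-same h₁ X (get h X))))
    , ext-p h₁ _ s (restore-≈ₕ (≔?-agreeOff h₁ X (get h X)) free₁) p₁
    , ext-q h₂ _ s (restore-≈ₕ (agreeOff-refl X h₂) free₂) q₂
    where
    free : get h₁ X ≡ nothing × get h₂ X ≡ nothing
    free = splitAt-nothing {h [ X ≔⊥]} {h₁} {h₂} {X} (≔?-same h X nothing) (sp X)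
    free₁ = proj₁ free
    free₂ = proj₂ free
  from : (([⟨ x ⟩≔⊥] p) ✱ ([⟨ x ⟩≔⊥] q)) h s → ([⟨ x ⟩≔⊥] (p ✱ q)) h s
  from (h₁ , h₂ , sp , p₁ , q₂) =
      h₁ [ X ≔⊥] , h₂ [ X ≔⊥]
    , split-≔? h h₁ h₂ X nothing sp
    , p₁ , q₂

clear-wand : ∀ (x y : Var) (p q : Assertion) → HeapExt p → HeapExt q →
             y ≢ x → FreshIn y p → FreshIn y q →
             ([⟨ x ⟩≔⊥] (p -✱ q))
               ≡ₐ (((p ∧ (∼ (x ↪-))) -✱ ([⟨ x ⟩≔⊥] q))
                   ∧ All y (([⟨ x ⟩≔ var y ] p) -✱ ([⟨ x ⟩≔ var y ] q)))
clear-wand x y p q ext-p ext-q y≢x fresh-p fresh-q h s = to , from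
  where
  X = s x
  to : ([⟨ x ⟩≔⊥] (p -✱ q)) h s →
       (((p ∧ (∼ (x ↪-))) -✱ ([⟨ x ⟩≔⊥] q))
        ∧ All y (([⟨ x ⟩≔ var y ] p) -✱ ([⟨ x ⟩≔ var y ] q))) h s
  to wand = unallocated-extension , allocated-extension
    where
    unallocated-extension : ((p ∧ (∼ (x ↪-))) -✱ ([⟨ x ⟩≔⊥] q)) h s
    unallocated-extension h₁ h₂ sp (p₁ , ¬alloc) =
      wand h₁ (h₂ [ X ≔⊥])
        (split-patch sp (≔?-agreeOff h₂ X nothing) (≔?-agreeOff h X nothing)
           (agreeOff-refl X h₁)
           (inj₁ (≔?-same h X nothing
                 , trans (≔?-same h₂ X nothing) (sym (¬allocated⇒nothing {h₁} ¬alloc)))))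
        p₁
    allocated-extension : All y (([⟨ x ⟩≔ var y ] p) -✱ ([⟨ x ⟩≔ var y ] q)) h s
    allocated-extension v h₁ h₂ sp p₁ =
      proj₂ (update-fresh y≢x fresh-q h₂ s v)
        (wand (h₁ [ X ≔ v ]) (h₂ [ X ≔ v ])
          (split-≔? h₂ h h₁ X (just v) sp)
          (proj₁ (update-fresh y≢x fresh-p h₁ s v) p₁))
  from : (((p ∧ (∼ (x ↪-))) -✱ ([⟨ x ⟩≔⊥] q))
          ∧ All y (([⟨ x ⟩≔ var y ] p) -✱ ([⟨ x ⟩≔ var y ] q))) h s →
         ([⟨ x ⟩≔⊥] (p -✱ q)) h s
  from (unallocated-wand , allocated-wand) h₁ h₂ sp p₁ = by-content (get h₁ X) refl
    where
    h₂' = h₂ [ X ≔? get h X ]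
    split-restored : ∀ {h₁'} → AgreeOff X h₁ h₁' → get h₁' X ≡ nothing → Split h₂' h h₁'
    split-restored a₁ free₁ =
      split-patch sp (≔?-agreeOff h₂ X (get h X))
        (agreeOff-sym (≔?-agreeOff h X nothing)) a₁
        (inj₂ (free₁ , ≔?-same h₂ X (get h X)))
    h₂≡h₁ : get h₂ X ≡ get h₁ X
    h₂≡h₁ = splitAt-right {h₂} {h [ X ≔⊥]} {h₁} {X} (≔?-same h X nothing) (sp X)
    restored : ∀ {m} → get h₁ X ≡ m → (h₂' [ X ≔? m ]) ≈ₕ h₂
    restored {m} h₁≡m k =
      sym (restore-≈ₕ (≔?-agreeOff h₂ X (get h X)) (trans h₂≡h₁ h₁≡m) k)
    by-content : ∀ m → get h₁ X ≡ m → q h₂ s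
    by-content nothing free₁ =
      ext-q (h₂' [ X ≔⊥]) h₂ s (restored free₁)
        (unallocated-wand h₁ h₂' (split-restored (agreeOff-refl X h₁) free₁)
           (p₁ , nothing⇒¬allocated {h₁} free₁))
    by-content (just v) stored =
      ext-q (h₂' [ X ≔ v ]) h₂ s (restored stored)
        (proj₁ (update-fresh y≢x fresh-q h₂' s v)
          (allocated-wand v (h₁ [ X ≔⊥]) h₂'
             (split-restored (≔?-agreeOff h₁ X nothing) (≔?-same h₁ X nothing))
             (proj₂ (update-fresh y≢x fresh-p (h₁ [ X ≔⊥]) s v)
                (ext-p h₁ ((h₁ [ X ≔⊥]) [ X ≔ v ]) s
                   (restore-≈ₕ (≔?-agreeOff h₁ X nothing) stored) p₁))))

lemma3p5 :
      (∀ (x : Var) (b : BExp) → ([⟨ x ⟩≔⊥] bool b) ≡ₐ bool b)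
    × (∀ (x : Var) (e e' : Exp) →
         ([⟨ x ⟩≔⊥] (e ↪ e')) ≡ₐ ((var x ≠ e) ∧ (e ↪ e')))
    × (∀ (x : Var) (p q : Assertion) → HeapExt p → HeapExt q →
         ([⟨ x ⟩≔⊥] (p ✱ q)) ≡ₐ (([⟨ x ⟩≔⊥] p) ✱ ([⟨ x ⟩≔⊥] q)))
    × (∀ (x y : Var) (p q : Assertion) → HeapExt p → HeapExt q →
         y ≢ x → FreshIn y p → FreshIn y q →
         ([⟨ x ⟩≔⊥] (p -✱ q))
           ≡ₐ (((p ∧ (∼ (x ↪-))) -✱ ([⟨ x ⟩≔⊥] q))
               ∧ All y (([⟨ x ⟩≔ var y ] p) -✱ ([⟨ x ⟩≔ var y ] q))))
lemma3p5 = clear-bool , clear-↪ , clear-✱ , clear-wand
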